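{- Over the calculus QHC (described in the context), the following equivalences of principles hold (each displayed schema is understood for all formulas of the indicated sorts): (a) The $?$-Principle $?(\alpha\to\beta)\leftrightarrow\Box(?\alpha\to ?\beta)$ is equivalent to each of: $!?(\alpha\to\beta)\leftrightarrow !(?\alpha\to ?\beta)$; $?(\alpha\to\beta)\leftrightarrow ?(\nabla\alpha\to\nabla\beta)$; $\nabla(\alpha\to\beta)\leftrightarrow(\nabla\alpha\to\nabla\beta)$. (b) The $\forall$-Principle $?\forall x\,\alpha(x)\leftrightarrow\Box\forall x\,?\alpha(x)$ is equivalent to each of: $!?\forall x\,\alpha(x)\leftrightarrow !\forall x\,?\alpha(x)$; $?\forall x\,\alpha(x)\leftrightarrow ?\forall x\,\nabla\alpha(x)$; $\nabla\forall x\,\alpha(x)\leftrightarrow\forall x\,\nabla\alpha(x)$. (c) The $\lor$-Principle $!(p\lor q)\leftrightarrow\nabla(!p\lor !q)$ is equivalent to each of: $?!(p\lor q)\leftrightarrow ?(!p\lor !q)$; $!(p\lor q)\leftrightarrow !(\Box p\lor\Box q)$; $\Box(p\lor q)\leftrightarrow\Box p\lor\Box q$. (d) The $\exists$-Principle $!\exists x\,p(x)\leftrightarrow\nabla\exists x\,!p(x)$ is equivalent to each of: $?!\exists x\,p(x)\leftrightarrow ?\exists x\,!p(x)$; $!\exists x\,p(x)\leftrightarrow !\exists x\,\Box p(x)$; $\Box\exists x\,p(x)\leftrightarrow\exists x\,\Box p(x)$. (e) The $!$-Principle $!(p\to q)\leftrightarrow\nabla(!p\to !q)$ is equivalent to each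 of: $?!(p\to q)\leftrightarrow ?(!p\to !q)$; $!(p\to q)\leftrightarrow !(\Box p\to\Box q)$; $\Box(p\to q)\leftrightarrow(\Box p\to\Box q)$. (e$'$) The $!$-Principle is also equivalent to each of: the $\bot$-Rule (from $\neg !p$ infer $\neg p$); $!(p\to q)\leftrightarrow(!p\to !q)$; $\Box p\leftrightarrow p$. (f) The $?$-Principle and the $\top$-Rule (from $?\alpha$ infer $\alpha$) taken together are equivalent to $\alpha\leftrightarrow\nabla\alpha$.
   Context: QHC (the joint logic of problems and propositions) is a two-sorted first-order calculus over a single domain of individuals. Formulas are of two sorts: propositions (letters $p,q$) and problems (letters $\alpha,\beta$). Propositions are built from atomic propositions and from expressions $?\alpha$ ($\alpha$ a problem) by the classical connectives $\land,\lor,\to,\neg$, the constant $0$ (falsity) and quantifiers $\forall x,\exists x$. Problems are built from atomic problems and from expressions $!p$ ($p$ a proposition) by the intuitionistic connectives $\land,\lor,\to,\neg$, the constant $\bot$ and quantifiers $\forall x,\exists x$. Derivability in QHC: all axioms and rules of classical predicate logic apply to propositions, all axioms and rules of intuitionistic predicate logic apply to problems, and in addition there are the inference rules "from $\alpha$ infer $?\alpha$" and "from $p$ infer $!p$", and the axiom schemes $?(\alpha\to\beta)\to(?\alpha\to ?\beta)$, $!(p\to q)\to(!p\to !q)$, $\neg !0$, $?!p\to p$, $\alpha\to !?\alpha$. Abbreviations: $\Box p:= ?!p$ for propositions, $\nabla\alpha := !?\alpha$ for problems; $A\leftrightarrow B$ abbreviates $(A\to B)\land(B\to A)$ in the appropriate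 sort. A "principle" is a schema added to QHC as extra axioms (all instances, for arbitrary formulas $\alpha,\beta,p,q$, variables $x$ and formulas $\alpha(x),p(x)$); a "rule" is an inference schema added to QHC. Two principles/rules (or conjunctions thereof) are equivalent if each is derivable in QHC extended by the other. -}

module Defs where

open import Data.Nat using (ℕ; zero; suc)
open import Data.List using (List; map)
open import Data.Product using (_×_; _,_)

-- Individual variables are de Bruijn indices (ℕ); the quantifiers
-- all / ex bind index 0.  Terms are individual variables.
-- Atomic formulas of either sort: a predicate symbol (ℕ) applied to a
-- list of variables.

data Sort : Set where
  prop prob : Sort

infixr 4 _⇒_
infixr 5 _∨_
infixr 6 _∧_
infix 9 ¿_ !_

data Fm : Sort → Set where
  atom : {s : Sort} → ℕ → List ℕ → Fm s
  ¿_   : Fm prob → Fm prop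
  !_   : Fm prop → Fm prob
  _∧_  : {s : Sort} → Fm s → Fm s → Fm s
  _∨_  : {s : Sort} → Fm s → Fm s → Fm s
  _⇒_  : {s : Sort} → Fm s → Fm s → Fm s
  fls  : {s : Sort} → Fm s          -- 0 (props) / ⊥ (problems)
  all  : {s : Sort} → Fm s → Fm s
  ex   : {s : Sort} → Fm s → Fm s

∼_ : {s : Sort} → Fm s → Fm s
∼ A = A ⇒ fls

infix 3 _⟺_
_⟺_ : {s : Sort} → Fm s → Fm s → Fm s
A ⟺ B = (A ⇒ B) ∧ (B ⇒ A)

□_ : Fm prop → Fm prop
□ p = ¿ (! p)

∇_ : Fm prob → Fm prob
∇ α = ! (¿ α)

infix 9 □_ ∇_
infix 8 ∼_

lift : (ℕ → ℕ) → ℕ → ℕ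
lift σ zero    = zero
lift σ (suc n) = suc (σ n)

ren : {s : Sort} → (ℕ → ℕ) → Fm s → Fm s
ren σ (atom P xs) = atom P (map σ xs)
ren σ (¿ α)       = ¿ ren σ α
ren σ (! p)       = ! ren σ p
ren σ (A ∧ B)     = ren σ A ∧ ren σ B
ren σ (A ∨ B)     = ren σ A ∨ ren σ B
ren σ (A ⇒ B)     = ren σ A ⇒ ren σ B
ren σ fls         = fls
ren σ (all A)     = all (ren (lift σ) A)
ren σ (ex A)      = ex (ren (lift σ) A)

-- weakening: shift all free variables up by one (the new variable 0
-- does not occur free in the result)
shift : {s : Sort} → Fm s → Fm s
shift = ren suc

inst1 : ℕ → ℕ → ℕ
inst1 t zero    = t
inst1 t (suc n) = n

_[_] : {s : Sort} → Fm s → ℕ → Fm s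
A [ t ] = ren (inst1 t) A

record Ext : Set₁ where
  field
    Ax   : (s : Sort) → Fm s → Set
    Rule : (s t : Sort) → Fm s → Fm t → Set

open Ext public

data Never : Set where

QHC₀ : Ext
QHC₀ = record { Ax = λ _ _ → Never ; Rule = λ _ _ _ _ → Never }

data Either (A B : Set) : Set where
  left  : A → Either A B
  right : B → Either A B

_⊕_ : Ext → Ext → Ext
E ⊕ F = record
  { Ax   = λ s A → Either (Ax E s A) (Ax F s A)
  ; Rule = λ s t A B → Either (Rule E s t A B) (Rule F s t A B) }

data AxInst {s : Sort} {P : Set} (f : P → Fm s) : (s' : Sort) → Fm s' → Set where
  inst : (x : P) → AxInst f s (f x)

principle : {s : Sort} {P : Set} → (P → Fm s) → Ext
principle f = record { Ax = AxInst f ; Rule = λ _ _ _ _ → Never }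

data RuleInst {s t : Sort} {P : Set} (prem : P → Fm s) (concl : P → Fm t)
     : (s' t' : Sort) → Fm s' → Fm t' → Set where
  inst : (x : P) → RuleInst prem concl s t (prem x) (concl x)

rule : {s t : Sort} {P : Set} → (P → Fm s) → (P → Fm t) → Ext
rule prem concl = record { Ax = λ _ _ → Never ; Rule = RuleInst prem concl }

infix 2 _⊢_

data _⊢_ (E : Ext) : {s : Sort} → Fm s → Set where
  K     : {s : Sort} {A B : Fm s} → E ⊢ A ⇒ B ⇒ A
  S     : {s : Sort} {A B C : Fm s} → E ⊢ (A ⇒ B ⇒ C) ⇒ (A ⇒ B) ⇒ A ⇒ C
  ∧E₁   : {s : Sort} {A B : Fm s} → E ⊢ A ∧ B ⇒ A
  ∧E₂   : {s : Sort} {A B : Fm s} → E ⊢ A ∧ B ⇒ B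
  ∧I    : {s : Sort} {A B : Fm s} → E ⊢ A ⇒ B ⇒ A ∧ B
  ∨I₁   : {s : Sort} {A B : Fm s} → E ⊢ A ⇒ A ∨ B
  ∨I₂   : {s : Sort} {A B : Fm s} → E ⊢ B ⇒ A ∨ B
  ∨E    : {s : Sort} {A B C : Fm s} → E ⊢ (A ⇒ C) ⇒ (B ⇒ C) ⇒ A ∨ B ⇒ C
  efq   : {s : Sort} {A : Fm s} → E ⊢ fls ⇒ A
  dne   : {p : Fm prop} → E ⊢ ∼ ∼ p ⇒ p
  ∀E    : {s : Sort} {A : Fm s} (t : ℕ) → E ⊢ all A ⇒ A [ t ]
  ∃I    : {s : Sort} {A : Fm s} (t : ℕ) → E ⊢ A [ t ] ⇒ ex A
  mp    : {s : Sort} {A B : Fm s} → E ⊢ A ⇒ B → E ⊢ A → E ⊢ B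
  ∀I    : {s : Sort} {A B : Fm s} → E ⊢ shift B ⇒ A → E ⊢ B ⇒ all A
  ∃E    : {s : Sort} {A B : Fm s} → E ⊢ A ⇒ shift B → E ⊢ ex A ⇒ B
  ?R    : {α : Fm prob} → E ⊢ α → E ⊢ ¿ α
  !R    : {p : Fm prop} → E ⊢ p → E ⊢ ! p
  ?K    : {α β : Fm prob} → E ⊢ ¿ (α ⇒ β) ⇒ ¿ α ⇒ ¿ β
  !K    : {p q : Fm prop} → E ⊢ ! (p ⇒ q) ⇒ ! p ⇒ ! q
  !0    : E ⊢ ∼ ! (fls {prop})
  ?!    : {p : Fm prop} → E ⊢ ¿ ! p ⇒ p
  !?    : {α : Fm prob} → E ⊢ α ⇒ ! ¿ α
  extAx   : {s : Sort} {A : Fm s} → Ax E s A → E ⊢ A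
  extRule : {s t : Sort} {A : Fm s} {B : Fm t} → Rule E s t A B → E ⊢ A → E ⊢ B

DerivableIn : Ext → Ext → Set
DerivableIn E F =
  ({s : Sort} {A : Fm s} → Ax E s A → F ⊢ A) ×
  ({s t : Sort} {A : Fm s} {B : Fm t} → Rule E s t A B → F ⊢ A → F ⊢ B)

_≋_ : Ext → Ext → Set
E ≋ F = DerivableIn E F × DerivableIn F E

infix 1 _≋_

?-Principle : Ext
?-Principle = principle {prop} {Fm prob × Fm prob} λ (α , β) → ¿ (α ⇒ β) ⟺ □ (¿ α ⇒ ¿ β)

?-a1 ?-a2 ?-a3 : Ext
?-a1 = principle {prob} {Fm prob × Fm prob} λ (α , β) → ! ¿ (α ⇒ β) ⟺ ! (¿ α ⇒ ¿ β)
?-a2 = principle {prop} {Fm prob × Fm prob} λ (α , β) → ¿ (α ⇒ β) ⟺ ¿ (∇ α ⇒ ∇ β)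
?-a3 = principle {prob} {Fm prob × Fm prob} λ (α , β) → ∇ (α ⇒ β) ⟺ (∇ α ⇒ ∇ β)

-- (b)  (α stands for α(x), x being de Bruijn index 0)
∀-Principle ∀-b1 ∀-b2 ∀-b3 : Ext
∀-Principle = principle {prop} {Fm prob} λ α → ¿ (all α) ⟺ □ (all (¿ α))
∀-b1 = principle {prob} {Fm prob} λ α → ! ¿ (all α) ⟺ ! (all (¿ α))
∀-b2 = principle {prop} {Fm prob} λ α → ¿ (all α) ⟺ ¿ (all (∇ α))
∀-b3 = principle {prob} {Fm prob} λ α → ∇ (all α) ⟺ all (∇ α)

∨-Principle ∨-c1 ∨-c2 ∨-c3 : Ext
∨-Principle = principle {prob} {Fm prop × Fm prop} λ (p , q) → ! (p ∨ q) ⟺ ∇ (! p ∨ ! q)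
∨-c1 = principle {prop} {Fm prop × Fm prop} λ (p , q) → ¿ ! (p ∨ q) ⟺ ¿ (! p ∨ ! q)
∨-c2 = principle {prob} {Fm prop × Fm prop} λ (p , q) → ! (p ∨ q) ⟺ ! (□ p ∨ □ q)
∨-c3 = principle {prop} {Fm prop × Fm prop} λ (p , q) → □ (p ∨ q) ⟺ □ p ∨ □ q

-- (d)  (p stands for p(x))
∃-Principle ∃-d1 ∃-d2 ∃-d3 : Ext
∃-Principle = principle {prob} {Fm prop} λ p → ! (ex p) ⟺ ∇ (ex (! p))
∃-d1 = principle {prop} {Fm prop} λ p → ¿ ! (ex p) ⟺ ¿ (ex (! p))
∃-d2 = principle {prob} {Fm prop} λ p → ! (ex p) ⟺ ! (ex (□ p))
∃-d3 = principle {prop} {Fm prop} λ p → □ (ex p) ⟺ ex (□ p)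

!-Principle !-e1 !-e2 !-e3 : Ext
!-Principle = principle {prob} {Fm prop × Fm prop} λ (p , q) → ! (p ⇒ q) ⟺ ∇ (! p ⇒ ! q)
!-e1 = principle {prop} {Fm prop × Fm prop} λ (p , q) → ¿ ! (p ⇒ q) ⟺ ¿ (! p ⇒ ! q)
!-e2 = principle {prob} {Fm prop × Fm prop} λ (p , q) → ! (p ⇒ q) ⟺ ! (□ p ⇒ □ q)
!-e3 = principle {prop} {Fm prop × Fm prop} λ (p , q) → □ (p ⇒ q) ⟺ (□ p ⇒ □ q)

⊥-Rule !-e4 !-e5 : Ext
⊥-Rule = rule {prob} {prop} {Fm prop} (λ p → ∼ ! p) (λ p → ∼ p)
!-e4 = principle {prob} {Fm prop × Fm prop} λ (p , q) → ! (p ⇒ q) ⟺ (! p ⇒ ! q)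
!-e5 = principle {prop} {Fm prop} λ p → □ p ⟺ p

⊤-Rule ∇-f : Ext
⊤-Rule = rule {prop} {prob} {Fm prob} (λ α → ¿ α) (λ α → α)
∇-f = principle {prob} {Fm prob} λ α → α ⟺ ∇ α

-- Every principle of a group is shown to be equivalent to one key schema,
-- so any two members of the group are equivalent.  In (a) and (b) the key is
-- the nontrivial half  □ C(?α) → ?C(α)  of "? commutes with C"; in (c) and (d)
-- it is  !C(p) → ∇ C(!p).  In (e) and (e') the key is the collapse  p → □p:
-- each principle turns a derivation of  !r → !0  into  □¬r, and for
-- r := p ∧ ¬□p such a derivation always exists, so ¬r, i.e. p → □p classically.
-- In (f) the key is  ∇α → α: the ?-Principle turns the axiom instance
-- □(?∇α → ?α) into ?(∇α → α), from which the ⊤-Rule removes the ?.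
module Submission where

open import Defs
open import Data.Product using (_×_; _,_; proj₂)
open import Data.Nat using (ℕ; zero; suc)
open import Data.List.Properties using (map-∘; map-cong; map-id)
open import Relation.Binary.PropositionalEquality using (_≡_; refl; cong; cong₂; trans; sym; subst)

lift-cancel : {σ τ : ℕ → ℕ} → (∀ n → σ (τ n) ≡ n) → ∀ n → lift σ (lift τ n) ≡ n
lift-cancel h zero    = refl
lift-cancel h (suc n) = cong suc (h n)

ren-cancel : {s : Sort} {σ τ : ℕ → ℕ} → (∀ n → σ (τ n) ≡ n) → (A : Fm s) → ren σ (ren τ A) ≡ A
ren-cancel h (atom P xs) = cong (atom P) (trans (sym (map-∘ xs)) (trans (map-cong h xs) (map-id xs)))
ren-cancel h (¿ A)       = cong ¿_ (ren-cancel h A)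
ren-cancel h (! A)       = cong !_ (ren-cancel h A)
ren-cancel h (A ∧ B)     = cong₂ _∧_ (ren-cancel h A) (ren-cancel h B)
ren-cancel h (A ∨ B)     = cong₂ _∨_ (ren-cancel h A) (ren-cancel h B)
ren-cancel h (A ⇒ B)     = cong₂ _⇒_ (ren-cancel h A) (ren-cancel h B)
ren-cancel h fls         = refl
ren-cancel h (all A)     = cong all (ren-cancel (lift-cancel h) A)
ren-cancel h (ex A)      = cong ex (ren-cancel (lift-cancel h) A)

-- ren (lift suc) B is B with the bound variable 0 added as a dummy.
dummy-[0] : {s : Sort} (B : Fm s) → ren (lift suc) B [ 0 ] ≡ B
dummy-[0] = ren-cancel inst1-lift-suc
  where
  inst1-lift-suc : ∀ n → inst1 0 (lift suc n) ≡ n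
  inst1-lift-suc zero    = refl
  inst1-lift-suc (suc n) = refl

module _ {E : Ext} where
  private variable
    s : Sort
    A A′ B C H : Fm s
    α β : Fm prob
    p q : Fm prop

  infixl 5 _⨾_
  _⨾_ : E ⊢ A ⇒ B → E ⊢ B ⇒ C → E ⊢ A ⇒ C
  f ⨾ g = mp (mp S (mp K g)) f

  mp⇒ : E ⊢ H ⇒ A ⇒ B → E ⊢ H ⇒ A → E ⊢ H ⇒ B
  mp⇒ f a = mp (mp S f) a

  ⇒-monoʳ : E ⊢ B ⇒ C → E ⊢ (A ⇒ B) ⇒ (A ⇒ C)
  ⇒-monoʳ g = mp S (mp K g)

  curry : E ⊢ H ∧ A ⇒ B → E ⊢ H ⇒ A ⇒ B
  curry g = ∧I ⨾ ⇒-monoʳ g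

  ⇒-antiˡ : E ⊢ A′ ⇒ A → E ⊢ (A ⇒ B) ⇒ (A′ ⇒ B)
  ⇒-antiˡ f = curry (mp⇒ ∧E₁ (∧E₂ ⨾ f))

  iff : E ⊢ A ⇒ B → E ⊢ B ⇒ A → E ⊢ A ⟺ B
  iff f g = mp (mp ∧I f) g

  fwd : E ⊢ A ⟺ B → E ⊢ A ⇒ B
  fwd = mp ∧E₁

  bwd : E ⊢ A ⟺ B → E ⊢ B ⇒ A
  bwd = mp ∧E₂

  ¿-mono : E ⊢ α ⇒ β → E ⊢ ¿ α ⇒ ¿ β
  ¿-mono f = mp ?K (?R f)

  !-mono : E ⊢ p ⇒ q → E ⊢ ! p ⇒ ! q
  !-mono f = mp !K (!R f)

  ∨-elim : E ⊢ A ⇒ C → E ⊢ B ⇒ C → E ⊢ A ∨ B ⇒ C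
  ∨-elim f g = mp (mp ∨E f) g

  ∃-intro₀ : (B : Fm s) → E ⊢ B ⇒ ex (ren (lift suc) B)
  ∃-intro₀ B = subst (λ D → E ⊢ D ⇒ ex (ren (lift suc) B)) (dummy-[0] B) (∃I 0)

  ∀-elim₀ : (B : Fm s) → E ⊢ all (ren (lift suc) B) ⇒ B
  ∀-elim₀ B = subst (λ D → E ⊢ all (ren (lift suc) B) ⇒ D) (dummy-[0] B) (∀E 0)

  ∃-mono : E ⊢ A ⇒ B → E ⊢ ex A ⇒ ex B
  ∃-mono {B = B} f = ∃E (f ⨾ ∃-intro₀ B)

  ∀-mono : E ⊢ A ⇒ B → E ⊢ all A ⇒ all B
  ∀-mono {A = A} f = ∀I (∀-elim₀ A ⨾ f)

  ¿-∨ : E ⊢ ¿ (α ∨ β) ⇒ ¿ α ∨ ¿ β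
  ¿-∨ = ¿-mono (∨-elim (!? ⨾ !-mono ∨I₁) (!? ⨾ !-mono ∨I₂)) ⨾ ?!

  ∨-¿ : E ⊢ ¿ α ∨ ¿ β ⇒ ¿ (α ∨ β)
  ∨-¿ = ∨-elim (¿-mono ∨I₁) (¿-mono ∨I₂)

  ∨-! : E ⊢ ! p ∨ ! q ⇒ ! (p ∨ q)
  ∨-! = ∨-elim (!-mono ∨I₁) (!-mono ∨I₂)

  ¿-∃ : E ⊢ ¿ (ex α) ⇒ ex (¿ α)
  ¿-∃ {α = α} = ¿-mono (∃E (!? ⨾ !-mono (∃-intro₀ (¿ α)))) ⨾ ?!

  ∃-¿ : E ⊢ ex (¿ α) ⇒ ¿ (ex α)
  ∃-¿ {α = α} = ∃E (¿-mono (∃-intro₀ α))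

  ∃-! : E ⊢ ex (! p) ⇒ ! (ex p)
  ∃-! {p = p} = ∃E (!-mono (∃-intro₀ p))

  ¿-∀ : E ⊢ ¿ (all α) ⇒ all (¿ α)
  ¿-∀ {α = α} = ∀I (¿-mono (∀-elim₀ α))

  !-∀ : E ⊢ ! (all p) ⇒ all (! p)
  !-∀ {p = p} = ∀I (!-mono (∀-elim₀ p))

record CharacterisedBy (Key : Ext → Set) (E : Ext) : Set₁ where
  field
    key       : ∀ {F} → DerivableIn E F → Key F
    derivable : ∀ {F} → Key F → DerivableIn E F

open CharacterisedBy

derivableIn-refl : {E : Ext} → DerivableIn E E
derivableIn-refl = extAx , extRule

≋-by-characterisation : {Key : Ext → Set} {E E′ : Ext} →
  CharacterisedBy Key E → CharacterisedBy Key E′ → E ≋ E′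
≋-by-characterisation c c′ =
  derivable c (key c′ derivableIn-refl) , derivable c′ (key c derivableIn-refl)

principle-characterisedBy : {Key : Ext → Set} {s : Sort} {P : Set} {f : P → Fm s} →
  (∀ {F} → (∀ x → F ⊢ f x) → Key F) → (∀ {F} → Key F → ∀ x → F ⊢ f x) →
  CharacterisedBy Key (principle f)
principle-characterisedBy to from = record
  { key       = λ (ax , _) → to (λ x → ax (inst x))
  ; derivable = λ k → (λ { (inst x) → from k x }) , λ () }

⊕-derivableIn : {E E′ F : Ext} → DerivableIn E F → DerivableIn E′ F → DerivableIn (E ⊕ E′) F
⊕-derivableIn (ax , rl) (ax′ , rl′) =
  (λ { (left a) → ax a ; (right a) → ax′ a }) , λ { (left r) → rl r ; (right r) → rl′ r }

⊕-derivableInˡ : {E E′ F : Ext} → DerivableIn (E ⊕ E′) F → DerivableIn E F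
⊕-derivableInˡ (ax , rl) = (λ a → ax (left a)) , λ r → rl (left r)

⊕-derivableInʳ : {E E′ F : Ext} → DerivableIn (E ⊕ E′) F → DerivableIn E′ F
⊕-derivableInʳ (ax , rl) = (λ a → ax (right a)) , λ r → rl (right r)

-- C x stands for a compound problem C(α) built by a connective or quantifier;
-- C? x and C∇ x are the same construction applied to ?α and to ∇α.
module ?-Commutation {P : Set} (C : P → Fm prob) (C? : P → Fm prop) (C∇ : P → Fm prob)
  (¿C⇒C? : ∀ {E} x → E ⊢ ¿ C x ⇒ C? x) (C⇒C∇ : ∀ {E} x → E ⊢ C x ⇒ C∇ x)
  (¿C∇⇒C? : ∀ {E} x → E ⊢ ¿ C∇ x ⇒ C? x) (!C?⇒C∇ : ∀ {E} x → E ⊢ ! C? x ⇒ C∇ x) where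

  Principle Variant₁ Variant₂ Variant₃ : Ext
  Principle = principle (λ x → ¿ C x ⟺ □ C? x)
  Variant₁  = principle (λ x → ! ¿ C x ⟺ ! C? x)
  Variant₂  = principle (λ x → ¿ C x ⟺ ¿ C∇ x)
  Variant₃  = principle (λ x → ∇ C x ⟺ C∇ x)

  Key : Ext → Set
  Key E = ∀ x → E ⊢ □ C? x ⇒ ¿ C x

  module _ {E : Ext} (k : Key E) where
    ¿C∇⇒¿C : ∀ x → E ⊢ ¿ C∇ x ⇒ ¿ C x
    ¿C∇⇒¿C x = ¿-mono !? ⨾ ¿-mono (!-mono (¿C∇⇒C? x)) ⨾ k x

    principle-from-key : ∀ x → E ⊢ ¿ C x ⟺ □ C? x
    principle-from-key x = iff (¿-mono !? ⨾ ¿-mono (!-mono (¿C⇒C? x))) (k x)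

    variant₁-from-key : ∀ x → E ⊢ ! ¿ C x ⟺ ! C? x
    variant₁-from-key x = iff (!-mono (¿C⇒C? x)) (!? ⨾ !-mono (k x))

    variant₂-from-key : ∀ x → E ⊢ ¿ C x ⟺ ¿ C∇ x
    variant₂-from-key x = iff (¿-mono (C⇒C∇ x)) (¿C∇⇒¿C x)

    variant₃-from-key : ∀ x → E ⊢ ∇ C x ⟺ C∇ x
    variant₃-from-key x = iff (!-mono (¿C⇒C? x) ⨾ !C?⇒C∇ x) (!? ⨾ !-mono (¿C∇⇒¿C x))

  principle-characterised : CharacterisedBy Key Principle
  principle-characterised = principle-characterisedBy (λ ax x → bwd (ax x)) principle-from-key

  variant₁-characterised : CharacterisedBy Key Variant₁
  variant₁-characterised =
    principle-characterisedBy (λ ax x → ¿-mono (bwd (ax x)) ⨾ ?!) variant₁-from-key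

  variant₂-characterised : CharacterisedBy Key Variant₂
  variant₂-characterised =
    principle-characterisedBy (λ ax x → ¿-mono (!C?⇒C∇ x) ⨾ bwd (ax x)) variant₂-from-key

  variant₃-characterised : CharacterisedBy Key Variant₃
  variant₃-characterised =
    principle-characterisedBy (λ ax x → ¿-mono (!C?⇒C∇ x) ⨾ ¿-mono (bwd (ax x)) ⨾ ?!) variant₃-from-key

  equivalences : (Principle ≋ Variant₁) × (Principle ≋ Variant₂) × (Principle ≋ Variant₃)
  equivalences =
    ≋-by-characterisation principle-characterised variant₁-characterised ,
    ≋-by-characterisation principle-characterised variant₂-characterised ,
    ≋-by-characterisation principle-characterised variant₃-characterised

-- Dually, C x is a compound proposition C(p), and C! x, C□ x are the same
-- construction applied to !p and to □p.
module !-Commutation {P : Set} (C : P → Fm prop) (C! : P → Fm prob) (C□ : P → Fm prop)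
  (C!⇒!C : ∀ {E} x → E ⊢ C! x ⇒ ! C x) (C□⇒C : ∀ {E} x → E ⊢ C□ x ⇒ C x)
  (C!⇒!C□ : ∀ {E} x → E ⊢ C! x ⇒ ! C□ x) (¿C!⇒C□ : ∀ {E} x → E ⊢ ¿ C! x ⇒ C□ x)
  (C□⇒¿C! : ∀ {E} x → E ⊢ C□ x ⇒ ¿ C! x) where

  Principle Variant₁ Variant₂ Variant₃ : Ext
  Principle = principle (λ x → ! C x ⟺ ∇ C! x)
  Variant₁  = principle (λ x → ¿ ! C x ⟺ ¿ C! x)
  Variant₂  = principle (λ x → ! C x ⟺ ! C□ x)
  Variant₃  = principle (λ x → □ C x ⟺ C□ x)

  Key : Ext → Set
  Key E = ∀ x → E ⊢ ! C x ⇒ ∇ C! x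

  module _ {E : Ext} (k : Key E) where
    principle-from-key : ∀ x → E ⊢ ! C x ⟺ ∇ C! x
    principle-from-key x = iff (k x) (!-mono (¿-mono (C!⇒!C x)) ⨾ !-mono ?!)

    variant₁-from-key : ∀ x → E ⊢ ¿ ! C x ⟺ ¿ C! x
    variant₁-from-key x = iff (¿-mono (k x) ⨾ ?!) (¿-mono (C!⇒!C x))

    variant₂-from-key : ∀ x → E ⊢ ! C x ⟺ ! C□ x
    variant₂-from-key x = iff (k x ⨾ !-mono (¿-mono (C!⇒!C□ x)) ⨾ !-mono ?!) (!-mono (C□⇒C x))

    variant₃-from-key : ∀ x → E ⊢ □ C x ⟺ C□ x
    variant₃-from-key x = iff (¿-mono (k x) ⨾ ?! ⨾ ¿C!⇒C□ x) (C□⇒¿C! x ⨾ ¿-mono (C!⇒!C x))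

  principle-characterised : CharacterisedBy Key Principle
  principle-characterised = principle-characterisedBy (λ ax x → fwd (ax x)) principle-from-key

  variant₁-characterised : CharacterisedBy Key Variant₁
  variant₁-characterised =
    principle-characterisedBy (λ ax x → !? ⨾ !-mono (fwd (ax x))) variant₁-from-key

  variant₂-characterised : CharacterisedBy Key Variant₂
  variant₂-characterised =
    principle-characterisedBy (λ ax x → fwd (ax x) ⨾ !-mono (C□⇒¿C! x)) variant₂-from-key

  variant₃-characterised : CharacterisedBy Key Variant₃
  variant₃-characterised =
    principle-characterisedBy (λ ax x → !? ⨾ !-mono (fwd (ax x)) ⨾ !-mono (C□⇒¿C! x)) variant₃-from-key

  equivalences : (Principle ≋ Variant₁) × (Principle ≋ Variant₂) × (Principle ≋ Variant₃)
  equivalences =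
    ≋-by-characterisation principle-characterised variant₁-characterised ,
    ≋-by-characterisation principle-characterised variant₂-characterised ,
    ≋-by-characterisation principle-characterised variant₃-characterised

module ?-⇒ = ?-Commutation {Fm prob × Fm prob}
  (λ (α , β) → α ⇒ β) (λ (α , β) → ¿ α ⇒ ¿ β) (λ (α , β) → ∇ α ⇒ ∇ β)
  (λ _ → ?K) (λ _ → !? ⨾ !-mono ?K ⨾ !K)
  (λ _ → ?K ⨾ ⇒-antiˡ (¿-mono !?) ⨾ ⇒-monoʳ ?!) (λ _ → !K)

module ?-∀ = ?-Commutation {Fm prob}
  all (λ α → all (¿ α)) (λ α → all (∇ α))
  (λ _ → ¿-∀) (λ _ → ∀-mono !?) (λ _ → ¿-∀ ⨾ ∀-mono ?!) (λ _ → !-∀)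

module !-∨ = !-Commutation {Fm prop × Fm prop}
  (λ (p , q) → p ∨ q) (λ (p , q) → ! p ∨ ! q) (λ (p , q) → □ p ∨ □ q)
  (λ _ → ∨-!) (λ _ → ∨-elim (?! ⨾ ∨I₁) (?! ⨾ ∨I₂))
  (λ _ → ∨-elim (!? ⨾ !-mono ∨I₁) (!? ⨾ !-mono ∨I₂)) (λ _ → ¿-∨) (λ _ → ∨-¿)

module !-∃ = !-Commutation {Fm prop}
  ex (λ p → ex (! p)) (λ p → ex (□ p))
  (λ _ → ∃-!) (λ _ → ∃-mono ?!) (λ _ → ∃-mono !? ⨾ ∃-!) (λ _ → ¿-∃) (λ _ → ∃-¿)

BoxCollapse : Ext → Set
BoxCollapse E = ∀ p → E ⊢ p ⇒ □ p

BoxedRefutation : Ext → Set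
BoxedRefutation E = ∀ r → E ⊢ ! r ⇒ ! fls → E ⊢ □ (∼ r)

module _ {E : Ext} where
  boxCollapse-from-boxedRefutation : BoxedRefutation E → BoxCollapse E
  boxCollapse-from-boxedRefutation refute p = curry (mp ?! (refute r !r⇒!0)) ⨾ dne
    where
    r : Fm prop
    r = p ∧ ∼ □ p
    -- !p gives !□p by the axiom α → ∇α, which clashes with !¬□p.
    !r⇒!0 : E ⊢ ! r ⇒ ! fls
    !r⇒!0 = mp⇒ (mp⇒ (mp K !K) (!-mono ∧E₂)) (!-mono ∧E₁ ⨾ !?)

  module _ (collapse : BoxCollapse E) {p q : Fm prop} where
    ⇒-□ : E ⊢ (p ⇒ q) ⇒ (□ p ⇒ □ q)
    ⇒-□ = ⇒-antiˡ ?! ⨾ ⇒-monoʳ (collapse q)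

    □-⇒ : E ⊢ (□ p ⇒ □ q) ⇒ (p ⇒ q)
    □-⇒ = ⇒-antiˡ (collapse p) ⨾ ⇒-monoʳ ?!

    ∇-!⇒!-⇒ : E ⊢ ∇ (! p ⇒ ! q) ⇒ ! (p ⇒ q)
    ∇-!⇒!-⇒ = !-mono (?K ⨾ □-⇒)

    !-principle-from-collapse : E ⊢ ! (p ⇒ q) ⟺ ∇ (! p ⇒ ! q)
    !-principle-from-collapse = iff (!K ⨾ !?) ∇-!⇒!-⇒

    e₁-from-collapse : E ⊢ ¿ ! (p ⇒ q) ⟺ ¿ (! p ⇒ ! q)
    e₁-from-collapse = iff (¿-mono !K) (¿-mono !? ⨾ ¿-mono ∇-!⇒!-⇒)

    e₂-from-collapse : E ⊢ ! (p ⇒ q) ⟺ ! (□ p ⇒ □ q)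
    e₂-from-collapse = iff (!-mono ⇒-□) (!-mono □-⇒)

    e₃-from-collapse : E ⊢ □ (p ⇒ q) ⟺ (□ p ⇒ □ q)
    e₃-from-collapse = iff (?! ⨾ ⇒-□) (□-⇒ ⨾ collapse (p ⇒ q))

    e₄-from-collapse : E ⊢ ! (p ⇒ q) ⟺ (! p ⇒ ! q)
    e₄-from-collapse = iff !K (!? ⨾ ∇-!⇒!-⇒)

  e₅-from-collapse : BoxCollapse E → {p : Fm prop} → E ⊢ □ p ⟺ p
  e₅-from-collapse collapse {p} = iff ?! (collapse p)

  ⊥-rule-from-collapse : BoxCollapse E → {p : Fm prop} → E ⊢ ∼ ! p → E ⊢ ∼ p
  ⊥-rule-from-collapse collapse ¬!p = mp ?! (?R (mp (∇-!⇒!-⇒ collapse) (mp !? (¬!p ⨾ efq))))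

-- The boxed refutations below only use the instances with q := 0.
collapse-characterisedBy : {s : Sort} {P : Set} {f : P → Fm s} →
  (∀ {F} → (∀ x → F ⊢ f x) → BoxedRefutation F) →
  (∀ {F} → BoxCollapse F → ∀ x → F ⊢ f x) → CharacterisedBy BoxCollapse (principle f)
collapse-characterisedBy refute =
  principle-characterisedBy (λ ax → boxCollapse-from-boxedRefutation (refute ax))

!-principle-characterised : CharacterisedBy BoxCollapse !-Principle
!-principle-characterised = collapse-characterisedBy
  (λ ax r h → ?R (mp (bwd (ax (r , fls))) (mp !? h)))
  (λ c _ → !-principle-from-collapse c)

e₁-characterised : CharacterisedBy BoxCollapse !-e1
e₁-characterised = collapse-characterisedBy
  (λ ax r h → mp (bwd (ax (r , fls))) (?R h))
  (λ c _ → e₁-from-collapse c)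

e₂-characterised : CharacterisedBy BoxCollapse !-e2
e₂-characterised = collapse-characterisedBy
  (λ ax r h → ?R (mp (bwd (ax (r , fls))) (!R (¿-mono h))))
  (λ c _ → e₂-from-collapse c)

e₃-characterised : CharacterisedBy BoxCollapse !-e3
e₃-characterised = collapse-characterisedBy
  (λ ax r h → mp (bwd (ax (r , fls))) (¿-mono h))
  (λ c _ → e₃-from-collapse c)

e₄-characterised : CharacterisedBy BoxCollapse !-e4
e₄-characterised = collapse-characterisedBy
  (λ ax r h → ?R (mp (bwd (ax (r , fls))) h))
  (λ c _ → e₄-from-collapse c)

e₅-characterised : CharacterisedBy BoxCollapse !-e5
e₅-characterised = principle-characterisedBy (λ ax p → bwd (ax p)) (λ c _ → e₅-from-collapse c)

⊥-rule-characterised : CharacterisedBy BoxCollapse ⊥-Rule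
⊥-rule-characterised = record
  { key       = λ (_ , rl) → boxCollapse-from-boxedRefutation
                  (λ r h → ?R (!R (rl (inst r) (h ⨾ !0))))
  ; derivable = λ c → (λ ()) , λ { (inst _) → ⊥-rule-from-collapse c } }

NablaCollapse : Ext → Set
NablaCollapse E = ∀ α → E ⊢ ∇ α ⇒ α

∇-f-characterised : CharacterisedBy NablaCollapse ∇-f
∇-f-characterised = principle-characterisedBy (λ ax α → bwd (ax α)) (λ c α → iff !? (c α))

?-principle-⊤-rule-characterised : CharacterisedBy NablaCollapse (?-Principle ⊕ ⊤-Rule)
?-principle-⊤-rule-characterised = record
  { key       = λ d α → proj₂ (⊕-derivableInʳ d) (inst (∇ α ⇒ α))
                  (mp (key ?-⇒.principle-characterised (⊕-derivableInˡ d) (∇ α , α)) (?R (!R ?!)))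
  ; derivable = λ c → ⊕-derivableIn
                  (derivable ?-⇒.principle-characterised (λ (α , β) →
                    ¿-mono !K ⨾ ¿-mono (⇒-antiˡ !? ⨾ ⇒-monoʳ (c β))))
                  ((λ ()) , λ { (inst α) d → mp (c α) (!R d) }) }

mainTheorem2 :
    ((?-Principle ≋ ?-a1) × (?-Principle ≋ ?-a2) × (?-Principle ≋ ?-a3)) ×
    ((∀-Principle ≋ ∀-b1) × (∀-Principle ≋ ∀-b2) × (∀-Principle ≋ ∀-b3)) ×
    ((∨-Principle ≋ ∨-c1) × (∨-Principle ≋ ∨-c2) × (∨-Principle ≋ ∨-c3)) ×
    ((∃-Principle ≋ ∃-d1) × (∃-Principle ≋ ∃-d2) × (∃-Principle ≋ ∃-d3)) ×
    ((!-Principle ≋ !-e1) × (!-Principle ≋ !-e2) × (!-Principle ≋ !-e3)) ×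
    ((!-Principle ≋ ⊥-Rule) × (!-Principle ≋ !-e4) × (!-Principle ≋ !-e5)) ×
    ((?-Principle ⊕ ⊤-Rule) ≋ ∇-f)
mainTheorem2 =
  ?-⇒.equivalences , ?-∀.equivalences , !-∨.equivalences , !-∃.equivalences ,
  (!-≋ e₁-characterised , !-≋ e₂-characterised , !-≋ e₃-characterised) ,
  (!-≋ ⊥-rule-characterised , !-≋ e₄-characterised , !-≋ e₅-characterised) ,
  ≋-by-characterisation ?-principle-⊤-rule-characterised ∇-f-characterised
  where
  !-≋ : {E : Ext} → CharacterisedBy BoxCollapse E → !-Principle ≋ E
  !-≋ = ≋-by-characterisation !-principle-characterised
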